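{- For all propositions $A,B,C$, variables $x,y$ and proof-terms $t_1,t_2,t_3$: if $t_1\in[\![A\vee B]\!]$, $(u/x)t_2\in[\![C]\!]$ for all $u\in[\![A]\!]$, and $(v/y)t_3\in[\![C]\!]$ for all $v\in[\![B]\!]$, then $\delta_\vee(t_1,[x]t_2,[y]t_3)\in[\![C]\!]$.
   Context: The $\odot$-calculus. Propositions: $A ::= \top \mid \bot \mid A \Rightarrow A \mid A \wedge A \mid A \vee A \mid A \odot A$. Proof-terms: $t ::= x \mid t \parallel u \mid * \mid \delta_\bot(t) \mid \lambda x\, t \mid t\,u \mid \langle t,u\rangle \mid \delta_\wedge(t,[x,y]u) \mid \mathrm{inl}(t) \mid \mathrm{inr}(t) \mid \delta_\vee(t,[x]u,[y]v) \mid t+u \mid \delta_\odot(t,[x]u,[y]v) \mid \delta_\odot^\parallel(t,[x]u,[y]v)$, where $\lambda x$ binds $x$, $[x,y]$ binds $x,y$, and $[x]$, $[y]$ bind $x$, $y$; $(u/x)t$ is capture-avoiding substitution. Ultra-reduction $\longrightarrow$ is the smallest contextual relation (closed under all term constructors) containing $\sigma l\to\sigma r$ for every substitution $\sigma$ and every rule $l\to r$ among: $(\lambda x\,t)\,u\to(u/x)t$; $\delta_\wedge(\langle t,u\rangle,[x,y]v)\to(t/x,u/y)v$; $\delta_\vee(\mathrm{inl}(t),[x]v,[y]w)\to(t/x)v$; $\delta_\vee(\mathrm{inr}(u),[x]v,[y]w)\to(u/y)w$; $\delta_\odot(t+u,[x]v,[y]w)\to(t/x)v$; $\delta_\odot(t+u,[x]v,[y]w)\to(u/y)w$;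 $\delta_\odot^\parallel(t+u,[x]v,[y]w)\to(t/x)v\parallel(u/y)w$; $(\lambda x\,t)\parallel(\lambda x\,u)\to\lambda x\,(t\parallel u)$; $\langle t,u\rangle\parallel\langle v,w\rangle\to\langle t\parallel v,u\parallel w\rangle$; $\delta_\vee(t\parallel u,[x]v,[y]w)\to\delta_\vee(t,[x]v,[y]w)\parallel\delta_\vee(u,[x]v,[y]w)$; $(t+u)\parallel(v+w)\to(t\parallel v)+(u\parallel w)$; $t\parallel t\to t$; $t\parallel u\to t$; $t\parallel u\to u$. $\longrightarrow^*$ is its reflexive-transitive closure; $t$ strongly terminates if there is no infinite ultra-reduction sequence from $t$. Sets $[\![A]\!]$ are defined by induction on $A$: $t\in[\![\top]\!]$ and $t\in[\![\bot]\!]$ iff $t$ strongly terminates; $t\in[\![A\Rightarrow B]\!]$ iff $t$ strongly terminates and whenever $t\longrightarrow^*\lambda x\,u$, then $(v/x)u\in[\![B]\!]$ for every $v\in[\![A]\!]$; $t\in[\![A\wedge B]\!]$ iff $t$ strongly terminates and whenever $t\longrightarrow^*\langle u,v\rangle$, then $u\in[\![A]\!]$ and $v\in[\![B]\!]$; $t\in[\![A\vee B]\!]$ iff $t$ strongly terminates, whenever $t\longrightarrow^*\mathrm{inl}(u)$ then $u\in[\![A]\!]$, and whenever $t\longrightarrow^*\mathrm{inr}(v)$ then $v\in[\![B]\!]$; $t\in[\![A\odot B]\!]$ iff $t$ strongly terminates and whenever $t\longrightarrow^* u+v$, then $u\in[\![A]\!]$ and $v\in[\![B]\!]$. -}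

module Defs where

open import Data.Nat using (ℕ; zero; suc)
open import Data.Product using (_×_)
open import Data.Unit using (⊤)
open import Induction.WellFounded using (Acc)
open import Relation.Binary.Construct.Closure.ReflexiveTransitive using (Star)

infixr 5 _⇒_
infixr 6 _∧_ _∨_ _⊙_

data Prop : Set where
  ⊤′ ⊥′ : Prop
  _⇒_ _∧_ _∨_ _⊙_ : Prop → Prop → Prop

-- Proof-terms (de Bruijn indices; terms are taken up to α-equivalence)
-- δ∧ t u   : u binds two variables: x = var 1, y = var 0
-- δ∨ t u v, δ⊙ t u v, δ⊙∥ t u v : u binds x (var 0), v binds y (var 0)

infixl 7 _·_
infixl 4 _∥_
infixl 5 _⊕_

data Term : Set where
  var   : ℕ → Term
  _∥_   : Term → Term → Term
  star  : Term
  δ⊥    : Term → Term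
  ƛ     : Term → Term
  _·_   : Term → Term → Term
  ⟨_,_⟩ : Term → Term → Term
  δ∧    : Term → Term → Term
  inl   : Term → Term
  inr   : Term → Term
  δ∨    : Term → Term → Term → Term
  _⊕_   : Term → Term → Term
  δ⊙    : Term → Term → Term → Term
  δ⊙∥   : Term → Term → Term → Term

ext : (ℕ → ℕ) → ℕ → ℕ
ext ρ zero    = zero
ext ρ (suc n) = suc (ρ n)

rename : (ℕ → ℕ) → Term → Term
rename ρ (var n)       = var (ρ n)
rename ρ (t ∥ u)       = rename ρ t ∥ rename ρ u
rename ρ star          = star
rename ρ (δ⊥ t)        = δ⊥ (rename ρ t)
rename ρ (ƛ t)         = ƛ (rename (ext ρ) t)
rename ρ (t · u)       = rename ρ t · rename ρ u
rename ρ ⟨ t , u ⟩     = ⟨ rename ρ t , rename ρ u ⟩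
rename ρ (δ∧ t u)      = δ∧ (rename ρ t) (rename (ext (ext ρ)) u)
rename ρ (inl t)       = inl (rename ρ t)
rename ρ (inr t)       = inr (rename ρ t)
rename ρ (δ∨ t u v)    = δ∨ (rename ρ t) (rename (ext ρ) u) (rename (ext ρ) v)
rename ρ (t ⊕ u)       = rename ρ t ⊕ rename ρ u
rename ρ (δ⊙ t u v)    = δ⊙ (rename ρ t) (rename (ext ρ) u) (rename (ext ρ) v)
rename ρ (δ⊙∥ t u v)   = δ⊙∥ (rename ρ t) (rename (ext ρ) u) (rename (ext ρ) v)

exts : (ℕ → Term) → ℕ → Term
exts σ zero    = var zero
exts σ (suc n) = rename suc (σ n)

subst : (ℕ → Term) → Term → Term
subst σ (var n)       = σ n
subst σ (t ∥ u)       = subst σ t ∥ subst σ u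
subst σ star          = star
subst σ (δ⊥ t)        = δ⊥ (subst σ t)
subst σ (ƛ t)         = ƛ (subst (exts σ) t)
subst σ (t · u)       = subst σ t · subst σ u
subst σ ⟨ t , u ⟩     = ⟨ subst σ t , subst σ u ⟩
subst σ (δ∧ t u)      = δ∧ (subst σ t) (subst (exts (exts σ)) u)
subst σ (inl t)       = inl (subst σ t)
subst σ (inr t)       = inr (subst σ t)
subst σ (δ∨ t u v)    = δ∨ (subst σ t) (subst (exts σ) u) (subst (exts σ) v)
subst σ (t ⊕ u)       = subst σ t ⊕ subst σ u
subst σ (δ⊙ t u v)    = δ⊙ (subst σ t) (subst (exts σ) u) (subst (exts σ) v)
subst σ (δ⊙∥ t u v)   = δ⊙∥ (subst σ t) (subst (exts σ) u) (subst (exts σ) v)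

-- (u/x)t where x is the outermost bound variable (index 0)
sub1 : Term → ℕ → Term
sub1 u zero    = u
sub1 u (suc n) = var n

_[_] : Term → Term → Term
t [ u ] = subst (sub1 u) t

-- (t/x,u/y)v where x = var 1, y = var 0
sub2 : Term → Term → ℕ → Term
sub2 t u zero          = u
sub2 t u (suc zero)    = t
sub2 t u (suc (suc n)) = var n

_[_,_] : Term → Term → Term → Term
v [ t , u ] = subst (sub2 t u) v

infix 3 _⟶_ _⟶*_

data _⟶_ : Term → Term → Set where
  β        : ∀ {t u} → (ƛ t) · u ⟶ t [ u ]
  β∧       : ∀ {t u v} → δ∧ ⟨ t , u ⟩ v ⟶ v [ t , u ]
  β∨l      : ∀ {t v w} → δ∨ (inl t) v w ⟶ v [ t ]
  β∨r      : ∀ {u v w} → δ∨ (inr u) v w ⟶ w [ u ]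
  β⊙l      : ∀ {t u v w} → δ⊙ (t ⊕ u) v w ⟶ v [ t ]
  β⊙r      : ∀ {t u v w} → δ⊙ (t ⊕ u) v w ⟶ w [ u ]
  β⊙∥      : ∀ {t u v w} → δ⊙∥ (t ⊕ u) v w ⟶ (v [ t ]) ∥ (w [ u ])
  ∥ƛ       : ∀ {t u} → ƛ t ∥ ƛ u ⟶ ƛ (t ∥ u)
  ∥pair    : ∀ {t u v w} → ⟨ t , u ⟩ ∥ ⟨ v , w ⟩ ⟶ ⟨ t ∥ v , u ∥ w ⟩
  ∥δ∨      : ∀ {t u v w} → δ∨ (t ∥ u) v w ⟶ δ∨ t v w ∥ δ∨ u v w
  ∥⊕       : ∀ {t u v w} → (t ⊕ u) ∥ (v ⊕ w) ⟶ (t ∥ v) ⊕ (u ∥ w)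
  ∥idem    : ∀ {t} → t ∥ t ⟶ t
  ∥l       : ∀ {t u} → t ∥ u ⟶ t
  ∥r       : ∀ {t u} → t ∥ u ⟶ u
  c∥₁      : ∀ {t t′ u} → t ⟶ t′ → t ∥ u ⟶ t′ ∥ u
  c∥₂      : ∀ {t u u′} → u ⟶ u′ → t ∥ u ⟶ t ∥ u′
  cδ⊥      : ∀ {t t′} → t ⟶ t′ → δ⊥ t ⟶ δ⊥ t′
  cƛ       : ∀ {t t′} → t ⟶ t′ → ƛ t ⟶ ƛ t′
  c·₁      : ∀ {t t′ u} → t ⟶ t′ → t · u ⟶ t′ · u
  c·₂      : ∀ {t u u′} → u ⟶ u′ → t · u ⟶ t · u′
  cpair₁   : ∀ {t t′ u} → t ⟶ t′ → ⟨ t , u ⟩ ⟶ ⟨ t′ , u ⟩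
  cpair₂   : ∀ {t u u′} → u ⟶ u′ → ⟨ t , u ⟩ ⟶ ⟨ t , u′ ⟩
  cδ∧₁     : ∀ {t t′ u} → t ⟶ t′ → δ∧ t u ⟶ δ∧ t′ u
  cδ∧₂     : ∀ {t u u′} → u ⟶ u′ → δ∧ t u ⟶ δ∧ t u′
  cinl     : ∀ {t t′} → t ⟶ t′ → inl t ⟶ inl t′
  cinr     : ∀ {t t′} → t ⟶ t′ → inr t ⟶ inr t′
  cδ∨₁     : ∀ {t t′ u v} → t ⟶ t′ → δ∨ t u v ⟶ δ∨ t′ u v
  cδ∨₂     : ∀ {t u u′ v} → u ⟶ u′ → δ∨ t u v ⟶ δ∨ t u′ v
  cδ∨₃     : ∀ {t u v v′} → v ⟶ v′ → δ∨ t u v ⟶ δ∨ t u v′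
  c⊕₁      : ∀ {t t′ u} → t ⟶ t′ → t ⊕ u ⟶ t′ ⊕ u
  c⊕₂      : ∀ {t u u′} → u ⟶ u′ → t ⊕ u ⟶ t ⊕ u′
  cδ⊙₁     : ∀ {t t′ u v} → t ⟶ t′ → δ⊙ t u v ⟶ δ⊙ t′ u v
  cδ⊙₂     : ∀ {t u u′ v} → u ⟶ u′ → δ⊙ t u v ⟶ δ⊙ t u′ v
  cδ⊙₃     : ∀ {t u v v′} → v ⟶ v′ → δ⊙ t u v ⟶ δ⊙ t u v′
  cδ⊙∥₁    : ∀ {t t′ u v} → t ⟶ t′ → δ⊙∥ t u v ⟶ δ⊙∥ t′ u v
  cδ⊙∥₂    : ∀ {t u u′ v} → u ⟶ u′ → δ⊙∥ t u v ⟶ δ⊙∥ t u′ v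
  cδ⊙∥₃    : ∀ {t u v v′} → v ⟶ v′ → δ⊙∥ t u v ⟶ δ⊙∥ t u v′

_⟶*_ : Term → Term → Set
_⟶*_ = Star _⟶_

_⟵_ : Term → Term → Set
u ⟵ t = t ⟶ u

SN : Term → Set
SN t = Acc _⟵_ t

⟦_⟧ : Prop → Term → Set
⟦ ⊤′ ⟧ t    = SN t
⟦ ⊥′ ⟧ t    = SN t
⟦ A ⇒ B ⟧ t = SN t × (∀ {u} → t ⟶* ƛ u → ∀ v → ⟦ A ⟧ v → ⟦ B ⟧ (u [ v ]))
⟦ A ∧ B ⟧ t = SN t × (∀ {u v} → t ⟶* ⟨ u , v ⟩ → ⟦ A ⟧ u × ⟦ B ⟧ v)
⟦ A ∨ B ⟧ t = SN t × (∀ {u} → t ⟶* inl u → ⟦ A ⟧ u)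
                   × (∀ {v} → t ⟶* inr v → ⟦ B ⟧ v)
⟦ A ⊙ B ⟧ t = SN t × (∀ {u v} → t ⟶* u ⊕ v → ⟦ A ⟧ u × ⟦ B ⟧ v)

-- The sets ⟦ C ⟧ are reducibility candidates: they contain only strongly
-- terminating terms, are closed under reduction, contain every neutral term all
-- of whose one-step reducts they contain, and are closed under ∥. A term
-- δ∨ t₁ t₂ t₃ is neutral, so it is shown to be in ⟦ C ⟧ by induction on the
-- strong termination of t₁, t₂ and t₃, inspecting its one-step reducts: the
-- β-reducts are covered by the hypotheses, the congruence reducts by induction,
-- and the reduct δ∨ t v w ∥ δ∨ u v w of δ∨ (t ∥ u) v w by induction and closure
-- under ∥. Strong termination of t₂ follows from that of t₂ [ x ], since
-- variables are reducible and substitution preserves reduction.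
module Submission where

open import Defs
open import Data.Nat using (ℕ; zero; suc)
open import Data.Product using (∃-syntax; _×_; _,_; proj₁; proj₂)
open import Data.Sum using (inj₁; inj₂)
open import Data.Empty using (⊥-elim)
open import Function using (_∘_; id; case_of_)
open import Induction.WellFounded using (Acc; acc; acc-inverse)
open import Relation.Binary.Construct.Closure.ReflexiveTransitive using (Star; ε; _◅_)
open import Relation.Binary.Construct.Union using (_∪_)
open import Relation.Binary.PropositionalEquality
  using (_≡_; _≗_; refl; sym; trans; cong; cong₂; module ≡-Reasoning)
open import Relation.Nullary using (¬_)

private
  variable
    a b s s′ t t′ u v w : Term
    ρ ρ₁ ρ₂ ρ₃ : ℕ → ℕ
    σ σ₁ σ₂ σ₃ τ : ℕ → Term

cong₃ : ∀ {A B C D : Set} (f : A → B → C → D) {x x′ y y′ z z′} →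
        x ≡ x′ → y ≡ y′ → z ≡ z′ → f x y z ≡ f x′ y′ z′
cong₃ f refl refl refl = refl

ext-fusion : ρ₁ ∘ ρ₂ ≗ ρ₃ → ext ρ₁ ∘ ext ρ₂ ≗ ext ρ₃
ext-fusion h zero    = refl
ext-fusion h (suc n) = cong suc (h n)

rename-fusion : ρ₁ ∘ ρ₂ ≗ ρ₃ → rename ρ₁ ∘ rename ρ₂ ≗ rename ρ₃
rename-fusion h (var n)     = cong var (h n)
rename-fusion h (t ∥ u)     = cong₂ _∥_ (rename-fusion h t) (rename-fusion h u)
rename-fusion h star        = refl
rename-fusion h (δ⊥ t)      = cong δ⊥ (rename-fusion h t)
rename-fusion h (ƛ t)       = cong ƛ (rename-fusion (ext-fusion h) t)
rename-fusion h (t · u)     = cong₂ _·_ (rename-fusion h t) (rename-fusion h u)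
rename-fusion h ⟨ t , u ⟩   = cong₂ ⟨_,_⟩ (rename-fusion h t) (rename-fusion h u)
rename-fusion h (δ∧ t u)    = cong₂ δ∧ (rename-fusion h t) (rename-fusion (ext-fusion (ext-fusion h)) u)
rename-fusion h (inl t)     = cong inl (rename-fusion h t)
rename-fusion h (inr t)     = cong inr (rename-fusion h t)
rename-fusion h (δ∨ t u v)  = cong₃ δ∨ (rename-fusion h t) (rename-fusion (ext-fusion h) u) (rename-fusion (ext-fusion h) v)
rename-fusion h (t ⊕ u)     = cong₂ _⊕_ (rename-fusion h t) (rename-fusion h u)
rename-fusion h (δ⊙ t u v)  = cong₃ δ⊙ (rename-fusion h t) (rename-fusion (ext-fusion h) u) (rename-fusion (ext-fusion h) v)
rename-fusion h (δ⊙∥ t u v) = cong₃ δ⊙∥ (rename-fusion h t) (rename-fusion (ext-fusion h) u) (rename-fusion (ext-fusion h) v)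

exts-ext-fusion : σ ∘ ρ ≗ τ → exts σ ∘ ext ρ ≗ exts τ
exts-ext-fusion h zero    = refl
exts-ext-fusion h (suc n) = cong (rename suc) (h n)

subst-rename-fusion : σ ∘ ρ ≗ τ → subst σ ∘ rename ρ ≗ subst τ
subst-rename-fusion h (var n)     = h n
subst-rename-fusion h (t ∥ u)     = cong₂ _∥_ (subst-rename-fusion h t) (subst-rename-fusion h u)
subst-rename-fusion h star        = refl
subst-rename-fusion h (δ⊥ t)      = cong δ⊥ (subst-rename-fusion h t)
subst-rename-fusion h (ƛ t)       = cong ƛ (subst-rename-fusion (exts-ext-fusion h) t)
subst-rename-fusion h (t · u)     = cong₂ _·_ (subst-rename-fusion h t) (subst-rename-fusion h u)
subst-rename-fusion h ⟨ t , u ⟩   = cong₂ ⟨_,_⟩ (subst-rename-fusion h t) (subst-rename-fusion h u)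
subst-rename-fusion h (δ∧ t u)    = cong₂ δ∧ (subst-rename-fusion h t) (subst-rename-fusion (exts-ext-fusion (exts-ext-fusion h)) u)
subst-rename-fusion h (inl t)     = cong inl (subst-rename-fusion h t)
subst-rename-fusion h (inr t)     = cong inr (subst-rename-fusion h t)
subst-rename-fusion h (δ∨ t u v)  = cong₃ δ∨ (subst-rename-fusion h t) (subst-rename-fusion (exts-ext-fusion h) u) (subst-rename-fusion (exts-ext-fusion h) v)
subst-rename-fusion h (t ⊕ u)     = cong₂ _⊕_ (subst-rename-fusion h t) (subst-rename-fusion h u)
subst-rename-fusion h (δ⊙ t u v)  = cong₃ δ⊙ (subst-rename-fusion h t) (subst-rename-fusion (exts-ext-fusion h) u) (subst-rename-fusion (exts-ext-fusion h) v)
subst-rename-fusion h (δ⊙∥ t u v) = cong₃ δ⊙∥ (subst-rename-fusion h t) (subst-rename-fusion (exts-ext-fusion h) u) (subst-rename-fusion (exts-ext-fusion h) v)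

ext-exts-fusion : rename ρ ∘ σ ≗ τ → rename (ext ρ) ∘ exts σ ≗ exts τ
ext-exts-fusion h zero = refl
ext-exts-fusion {ρ} {σ} {τ} h (suc n) = begin
  rename (ext ρ) (rename suc (σ n)) ≡⟨ rename-fusion (λ _ → refl) (σ n) ⟩
  rename (suc ∘ ρ) (σ n)            ≡⟨ sym (rename-fusion (λ _ → refl) (σ n)) ⟩
  rename suc (rename ρ (σ n))       ≡⟨ cong (rename suc) (h n) ⟩
  rename suc (τ n)                  ∎
  where open ≡-Reasoning

rename-subst-fusion : rename ρ ∘ σ ≗ τ → rename ρ ∘ subst σ ≗ subst τ
rename-subst-fusion h (var n)     = h n
rename-subst-fusion h (t ∥ u)     = cong₂ _∥_ (rename-subst-fusion h t) (rename-subst-fusion h u)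
rename-subst-fusion h star        = refl
rename-subst-fusion h (δ⊥ t)      = cong δ⊥ (rename-subst-fusion h t)
rename-subst-fusion h (ƛ t)       = cong ƛ (rename-subst-fusion (ext-exts-fusion h) t)
rename-subst-fusion h (t · u)     = cong₂ _·_ (rename-subst-fusion h t) (rename-subst-fusion h u)
rename-subst-fusion h ⟨ t , u ⟩   = cong₂ ⟨_,_⟩ (rename-subst-fusion h t) (rename-subst-fusion h u)
rename-subst-fusion h (δ∧ t u)    = cong₂ δ∧ (rename-subst-fusion h t) (rename-subst-fusion (ext-exts-fusion (ext-exts-fusion h)) u)
rename-subst-fusion h (inl t)     = cong inl (rename-subst-fusion h t)
rename-subst-fusion h (inr t)     = cong inr (rename-subst-fusion h t)
rename-subst-fusion h (δ∨ t u v)  = cong₃ δ∨ (rename-subst-fusion h t) (rename-subst-fusion (ext-exts-fusion h) u) (rename-subst-fusion (ext-exts-fusion h) v)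
rename-subst-fusion h (t ⊕ u)     = cong₂ _⊕_ (rename-subst-fusion h t) (rename-subst-fusion h u)
rename-subst-fusion h (δ⊙ t u v)  = cong₃ δ⊙ (rename-subst-fusion h t) (rename-subst-fusion (ext-exts-fusion h) u) (rename-subst-fusion (ext-exts-fusion h) v)
rename-subst-fusion h (δ⊙∥ t u v) = cong₃ δ⊙∥ (rename-subst-fusion h t) (rename-subst-fusion (ext-exts-fusion h) u) (rename-subst-fusion (ext-exts-fusion h) v)

exts-fusion : subst σ₁ ∘ σ₂ ≗ σ₃ → subst (exts σ₁) ∘ exts σ₂ ≗ exts σ₃
exts-fusion h zero = refl
exts-fusion {σ₁} {σ₂} {σ₃} h (suc n) = begin
  subst (exts σ₁) (rename suc (σ₂ n)) ≡⟨ subst-rename-fusion (λ _ → refl) (σ₂ n) ⟩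
  subst (rename suc ∘ σ₁) (σ₂ n)      ≡⟨ sym (rename-subst-fusion (λ _ → refl) (σ₂ n)) ⟩
  rename suc (subst σ₁ (σ₂ n))        ≡⟨ cong (rename suc) (h n) ⟩
  rename suc (σ₃ n)                   ∎
  where open ≡-Reasoning

subst-fusion : subst σ₁ ∘ σ₂ ≗ σ₃ → subst σ₁ ∘ subst σ₂ ≗ subst σ₃
subst-fusion h (var n)     = h n
subst-fusion h (t ∥ u)     = cong₂ _∥_ (subst-fusion h t) (subst-fusion h u)
subst-fusion h star        = refl
subst-fusion h (δ⊥ t)      = cong δ⊥ (subst-fusion h t)
subst-fusion h (ƛ t)       = cong ƛ (subst-fusion (exts-fusion h) t)
subst-fusion h (t · u)     = cong₂ _·_ (subst-fusion h t) (subst-fusion h u)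
subst-fusion h ⟨ t , u ⟩   = cong₂ ⟨_,_⟩ (subst-fusion h t) (subst-fusion h u)
subst-fusion h (δ∧ t u)    = cong₂ δ∧ (subst-fusion h t) (subst-fusion (exts-fusion (exts-fusion h)) u)
subst-fusion h (inl t)     = cong inl (subst-fusion h t)
subst-fusion h (inr t)     = cong inr (subst-fusion h t)
subst-fusion h (δ∨ t u v)  = cong₃ δ∨ (subst-fusion h t) (subst-fusion (exts-fusion h) u) (subst-fusion (exts-fusion h) v)
subst-fusion h (t ⊕ u)     = cong₂ _⊕_ (subst-fusion h t) (subst-fusion h u)
subst-fusion h (δ⊙ t u v)  = cong₃ δ⊙ (subst-fusion h t) (subst-fusion (exts-fusion h) u) (subst-fusion (exts-fusion h) v)
subst-fusion h (δ⊙∥ t u v) = cong₃ δ⊙∥ (subst-fusion h t) (subst-fusion (exts-fusion h) u) (subst-fusion (exts-fusion h) v)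

exts-var : σ ≗ var → exts σ ≗ var
exts-var h zero    = refl
exts-var h (suc n) = cong (rename suc) (h n)

subst-var : σ ≗ var → subst σ ≗ id
subst-var h (var n)     = h n
subst-var h (t ∥ u)     = cong₂ _∥_ (subst-var h t) (subst-var h u)
subst-var h star        = refl
subst-var h (δ⊥ t)      = cong δ⊥ (subst-var h t)
subst-var h (ƛ t)       = cong ƛ (subst-var (exts-var h) t)
subst-var h (t · u)     = cong₂ _·_ (subst-var h t) (subst-var h u)
subst-var h ⟨ t , u ⟩   = cong₂ ⟨_,_⟩ (subst-var h t) (subst-var h u)
subst-var h (δ∧ t u)    = cong₂ δ∧ (subst-var h t) (subst-var (exts-var (exts-var h)) u)
subst-var h (inl t)     = cong inl (subst-var h t)
subst-var h (inr t)     = cong inr (subst-var h t)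
subst-var h (δ∨ t u v)  = cong₃ δ∨ (subst-var h t) (subst-var (exts-var h) u) (subst-var (exts-var h) v)
subst-var h (t ⊕ u)     = cong₂ _⊕_ (subst-var h t) (subst-var h u)
subst-var h (δ⊙ t u v)  = cong₃ δ⊙ (subst-var h t) (subst-var (exts-var h) u) (subst-var (exts-var h) v)
subst-var h (δ⊙∥ t u v) = cong₃ δ⊙∥ (subst-var h t) (subst-var (exts-var h) u) (subst-var (exts-var h) v)

subst-weaken : ∀ σ t → subst σ (rename suc t) ≡ subst (σ ∘ suc) t
subst-weaken σ = subst-rename-fusion (λ _ → refl)

subst-[] : ∀ σ t u → subst σ (t [ u ]) ≡ subst (exts σ) t [ subst σ u ]
subst-[] σ t u = trans (subst-fusion (λ _ → refl) t) (sym (subst-fusion exts-sub1 t))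
  where
  exts-sub1 : subst (sub1 (subst σ u)) ∘ exts σ ≗ subst σ ∘ sub1 u
  exts-sub1 zero    = refl
  exts-sub1 (suc n) = trans (subst-weaken _ (σ n)) (subst-var (λ _ → refl) (σ n))

subst-[,] : ∀ σ v t u → subst σ (_[_,_] v t u) ≡ _[_,_] (subst (exts (exts σ)) v) (subst σ t) (subst σ u)
subst-[,] σ v t u = trans (subst-fusion (λ _ → refl) v) (sym (subst-fusion exts-sub2 v))
  where
  exts-sub2 : subst (sub2 (subst σ t) (subst σ u)) ∘ exts (exts σ) ≗ subst σ ∘ sub2 t u
  exts-sub2 zero          = refl
  exts-sub2 (suc zero)    = refl
  exts-sub2 (suc (suc n)) = begin
    subst (sub2 _ _) (rename suc (rename suc (σ n))) ≡⟨ subst-weaken _ (rename suc (σ n)) ⟩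
    subst (sub2 _ _ ∘ suc) (rename suc (σ n))        ≡⟨ subst-weaken _ (σ n) ⟩
    subst var (σ n)                                  ≡⟨ subst-var (λ _ → refl) (σ n) ⟩
    σ n                                              ∎
    where open ≡-Reasoning

subst-⟶ : t ⟶ t′ → subst σ t ⟶ subst σ t′
subst-⟶ {σ = σ} (β {t} {u})          rewrite subst-[] σ t u = β
subst-⟶ {σ = σ} (β∧ {t} {u} {v})     rewrite subst-[,] σ v t u = β∧
subst-⟶ {σ = σ} (β∨l {t} {v})        rewrite subst-[] σ v t = β∨l
subst-⟶ {σ = σ} (β∨r {u} {v} {w})    rewrite subst-[] σ w u = β∨r
subst-⟶ {σ = σ} (β⊙l {t} {u} {v})    rewrite subst-[] σ v t = β⊙l
subst-⟶ {σ = σ} (β⊙r {t} {u} {v} {w}) rewrite subst-[] σ w u = β⊙r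
subst-⟶ {σ = σ} (β⊙∥ {t} {u} {v} {w}) rewrite subst-[] σ v t | subst-[] σ w u = β⊙∥
subst-⟶ ∥ƛ          = ∥ƛ
subst-⟶ ∥pair       = ∥pair
subst-⟶ ∥δ∨         = ∥δ∨
subst-⟶ ∥⊕          = ∥⊕
subst-⟶ ∥idem       = ∥idem
subst-⟶ ∥l          = ∥l
subst-⟶ ∥r          = ∥r
subst-⟶ (c∥₁ r)     = c∥₁ (subst-⟶ r)
subst-⟶ (c∥₂ r)     = c∥₂ (subst-⟶ r)
subst-⟶ (cδ⊥ r)     = cδ⊥ (subst-⟶ r)
subst-⟶ (cƛ r)      = cƛ (subst-⟶ r)
subst-⟶ (c·₁ r)     = c·₁ (subst-⟶ r)
subst-⟶ (c·₂ r)     = c·₂ (subst-⟶ r)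
subst-⟶ (cpair₁ r)  = cpair₁ (subst-⟶ r)
subst-⟶ (cpair₂ r)  = cpair₂ (subst-⟶ r)
subst-⟶ (cδ∧₁ r)    = cδ∧₁ (subst-⟶ r)
subst-⟶ (cδ∧₂ r)    = cδ∧₂ (subst-⟶ r)
subst-⟶ (cinl r)    = cinl (subst-⟶ r)
subst-⟶ (cinr r)    = cinr (subst-⟶ r)
subst-⟶ (cδ∨₁ r)    = cδ∨₁ (subst-⟶ r)
subst-⟶ (cδ∨₂ r)    = cδ∨₂ (subst-⟶ r)
subst-⟶ (cδ∨₃ r)    = cδ∨₃ (subst-⟶ r)
subst-⟶ (c⊕₁ r)     = c⊕₁ (subst-⟶ r)
subst-⟶ (c⊕₂ r)     = c⊕₂ (subst-⟶ r)
subst-⟶ (cδ⊙₁ r)    = cδ⊙₁ (subst-⟶ r)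
subst-⟶ (cδ⊙₂ r)    = cδ⊙₂ (subst-⟶ r)
subst-⟶ (cδ⊙₃ r)    = cδ⊙₃ (subst-⟶ r)
subst-⟶ (cδ⊙∥₁ r)   = cδ⊙∥₁ (subst-⟶ r)
subst-⟶ (cδ⊙∥₂ r)   = cδ⊙∥₂ (subst-⟶ r)
subst-⟶ (cδ⊙∥₃ r)   = cδ⊙∥₃ (subst-⟶ r)

subst-⟶* : t ⟶* t′ → subst σ t ⟶* subst σ t′
subst-⟶* ε        = ε
subst-⟶* (r ◅ rs) = subst-⟶ r ◅ subst-⟶* rs

ƛ-⟶* : ƛ t ⟶* s → ∃[ t′ ] s ≡ ƛ t′ × t ⟶* t′
ƛ-⟶* ε = _ , refl , ε
ƛ-⟶* (cƛ r ◅ rs) with ƛ-⟶* rs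
... | _ , refl , rs′ = _ , refl , r ◅ rs′

pair-⟶* : ⟨ t , u ⟩ ⟶* s → ∃[ t′ ] ∃[ u′ ] s ≡ ⟨ t′ , u′ ⟩ × t ⟶* t′ × u ⟶* u′
pair-⟶* ε = _ , _ , refl , ε , ε
pair-⟶* (cpair₁ r ◅ rs) with pair-⟶* rs
... | _ , _ , refl , rs₁ , rs₂ = _ , _ , refl , r ◅ rs₁ , rs₂
pair-⟶* (cpair₂ r ◅ rs) with pair-⟶* rs
... | _ , _ , refl , rs₁ , rs₂ = _ , _ , refl , rs₁ , r ◅ rs₂

⊕-⟶* : t ⊕ u ⟶* s → ∃[ t′ ] ∃[ u′ ] s ≡ t′ ⊕ u′ × t ⟶* t′ × u ⟶* u′
⊕-⟶* ε = _ , _ , refl , ε , ε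
⊕-⟶* (c⊕₁ r ◅ rs) with ⊕-⟶* rs
... | _ , _ , refl , rs₁ , rs₂ = _ , _ , refl , r ◅ rs₁ , rs₂
⊕-⟶* (c⊕₂ r ◅ rs) with ⊕-⟶* rs
... | _ , _ , refl , rs₁ , rs₂ = _ , _ , refl , rs₁ , r ◅ rs₂

SN-reflect : (f : Term → Term) → (∀ {t t′} → t ⟶ t′ → f t ⟶ f t′) → SN (f t) → SN t
SN-reflect f f-mono (acc rs) = acc λ r → SN-reflect f f-mono (rs (f-mono r))

SN-ƛ : SN t → SN (ƛ t)
SN-ƛ (acc rs) = acc λ { (cƛ r) → SN-ƛ (rs r) }

SN-pair : SN t → SN u → SN ⟨ t , u ⟩
SN-pair (acc rt) (acc ru) = acc λ
  { (cpair₁ r) → SN-pair (rt r) (acc ru)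
  ; (cpair₂ r) → SN-pair (acc rt) (ru r)
  }

SN-⊕ : SN t → SN u → SN (t ⊕ u)
SN-⊕ (acc rt) (acc ru) = acc λ
  { (c⊕₁ r) → SN-⊕ (rt r) (acc ru)
  ; (c⊕₂ r) → SN-⊕ (acc rt) (ru r)
  }

-- ∥ commutes with ƛ, ⟨_,_⟩ and ⊕, so termination of a ∥ b is proved by
-- induction on reduction together with passage to these immediate subterms.
infix 3 _◁_ _≺_

data _◁_ : Term → Term → Set where
  ◁ƛ     : t ◁ ƛ t
  ◁pair₁ : t ◁ ⟨ t , u ⟩
  ◁pair₂ : u ◁ ⟨ t , u ⟩
  ◁⊕₁    : t ◁ t ⊕ u
  ◁⊕₂    : u ◁ t ⊕ u

_≺_ : Term → Term → Set
_≺_ = _⟵_ ∪ _◁_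

◁-lift : s ◁ t → s ⟶ s′ → ∃[ t′ ] t ⟶ t′ × s′ ◁ t′
◁-lift ◁ƛ     r = _ , cƛ r , ◁ƛ
◁-lift ◁pair₁ r = _ , cpair₁ r , ◁pair₁
◁-lift ◁pair₂ r = _ , cpair₂ r , ◁pair₂
◁-lift ◁⊕₁    r = _ , c⊕₁ r , ◁⊕₁
◁-lift ◁⊕₂    r = _ , c⊕₂ r , ◁⊕₂

◁*-lift : Star _◁_ s t → s ⟶ s′ → ∃[ t′ ] t ⟶ t′ × Star _◁_ s′ t′
◁*-lift ε        r = _ , r , ε
◁*-lift (p ◅ ps) r with ◁-lift p r
... | _ , r′ , p′ with ◁*-lift ps r′
...   | _ , r″ , ps′ = _ , r″ , p′ ◅ ps′

SN-◁*-Acc≺ : SN t → ∀ s → Star _◁_ s t → Acc _≺_ s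
SN-◁*-≺ : SN t → ∀ s → Star _◁_ s t → s′ ≺ s → Acc _≺_ s′

SN-◁*-Acc≺ sn s ps = acc (SN-◁*-≺ sn s ps)

SN-◁*-≺ (acc rs) s ps (inj₁ r) with ◁*-lift ps r
... | _ , r′ , ps′ = SN-◁*-Acc≺ (rs r′) _ ps′
SN-◁*-≺ sn (ƛ t)     ps (inj₂ ◁ƛ)     = SN-◁*-Acc≺ sn t (◁ƛ ◅ ps)
SN-◁*-≺ sn ⟨ t , u ⟩ ps (inj₂ ◁pair₁) = SN-◁*-Acc≺ sn t (◁pair₁ ◅ ps)
SN-◁*-≺ sn ⟨ t , u ⟩ ps (inj₂ ◁pair₂) = SN-◁*-Acc≺ sn u (◁pair₂ ◅ ps)
SN-◁*-≺ sn (t ⊕ u)   ps (inj₂ ◁⊕₁)    = SN-◁*-Acc≺ sn t (◁⊕₁ ◅ ps)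
SN-◁*-≺ sn (t ⊕ u)   ps (inj₂ ◁⊕₂)    = SN-◁*-Acc≺ sn u (◁⊕₂ ◅ ps)

SN⇒Acc≺ : SN t → Acc _≺_ t
SN⇒Acc≺ sn = SN-◁*-Acc≺ sn _ ε

Acc≺⇒SN : Acc _≺_ t → SN t
Acc≺⇒SN (acc rs) = acc λ r → Acc≺⇒SN (rs (inj₁ r))

SN-∥-Acc≺ : Acc _≺_ a → Acc _≺_ b → SN (a ∥ b)
SN-∥-reduct : Acc _≺_ a → Acc _≺_ b → a ∥ b ⟶ s → SN s

SN-∥-Acc≺ pa pb = acc (SN-∥-reduct pa pb)

SN-∥-reduct (acc ra) (acc rb) ∥ƛ =
  SN-ƛ (SN-∥-Acc≺ (ra (inj₂ ◁ƛ)) (rb (inj₂ ◁ƛ)))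
SN-∥-reduct (acc ra) (acc rb) ∥pair =
  SN-pair (SN-∥-Acc≺ (ra (inj₂ ◁pair₁)) (rb (inj₂ ◁pair₁)))
          (SN-∥-Acc≺ (ra (inj₂ ◁pair₂)) (rb (inj₂ ◁pair₂)))
SN-∥-reduct (acc ra) (acc rb) ∥⊕ =
  SN-⊕ (SN-∥-Acc≺ (ra (inj₂ ◁⊕₁)) (rb (inj₂ ◁⊕₁)))
       (SN-∥-Acc≺ (ra (inj₂ ◁⊕₂)) (rb (inj₂ ◁⊕₂)))
SN-∥-reduct pa       pb       ∥idem    = Acc≺⇒SN pa
SN-∥-reduct pa       pb       ∥l       = Acc≺⇒SN pa
SN-∥-reduct pa       pb       ∥r       = Acc≺⇒SN pb
SN-∥-reduct (acc ra) pb       (c∥₁ r)  = SN-∥-Acc≺ (ra (inj₁ r)) pb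
SN-∥-reduct pa       (acc rb) (c∥₂ r)  = SN-∥-Acc≺ pa (rb (inj₁ r))

SN-∥ : SN a → SN b → SN (a ∥ b)
SN-∥ sa sb = SN-∥-Acc≺ (SN⇒Acc≺ sa) (SN⇒Acc≺ sb)

SN-ƛ-∥ : SN (ƛ t) → SN (ƛ u) → SN (ƛ (t ∥ u))
SN-ƛ-∥ st su = SN-ƛ (SN-∥ (SN-reflect ƛ cƛ st) (SN-reflect ƛ cƛ su))

SN-pair-∥ : SN ⟨ t , u ⟩ → SN ⟨ v , w ⟩ → SN ⟨ t ∥ v , u ∥ w ⟩
SN-pair-∥ stu svw = SN-pair (SN-∥ (SN-reflect _ cpair₁ stu) (SN-reflect _ cpair₁ svw))
                            (SN-∥ (SN-reflect _ cpair₂ stu) (SN-reflect _ cpair₂ svw))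

SN-⊕-∥ : SN (t ⊕ u) → SN (v ⊕ w) → SN ((t ∥ v) ⊕ (u ∥ w))
SN-⊕-∥ stu svw = SN-⊕ (SN-∥ (SN-reflect _ c⊕₁ stu) (SN-reflect _ c⊕₁ svw))
                      (SN-∥ (SN-reflect _ c⊕₂ stu) (SN-reflect _ c⊕₂ svw))

⟦⟧-SN : ∀ C → ⟦ C ⟧ t → SN t
⟦⟧-SN ⊤′      h = h
⟦⟧-SN ⊥′      h = h
⟦⟧-SN (A ⇒ B) h = proj₁ h
⟦⟧-SN (A ∧ B) h = proj₁ h
⟦⟧-SN (A ∨ B) h = proj₁ h
⟦⟧-SN (A ⊙ B) h = proj₁ h

⟦⟧-⟶ : ∀ C → ⟦ C ⟧ t → t ⟶ t′ → ⟦ C ⟧ t′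
⟦⟧-⟶ ⊤′      h             r = acc-inverse h r
⟦⟧-⟶ ⊥′      h             r = acc-inverse h r
⟦⟧-⟶ (A ⇒ B) (sn , f)      r = acc-inverse sn r , f ∘ (r ◅_)
⟦⟧-⟶ (A ∧ B) (sn , f)      r = acc-inverse sn r , f ∘ (r ◅_)
⟦⟧-⟶ (A ∨ B) (sn , f , g)  r = acc-inverse sn r , f ∘ (r ◅_) , g ∘ (r ◅_)
⟦⟧-⟶ (A ⊙ B) (sn , f)      r = acc-inverse sn r , f ∘ (r ◅_)

⟦⟧-⟶* : ∀ C → ⟦ C ⟧ t → t ⟶* t′ → ⟦ C ⟧ t′
⟦⟧-⟶* C h ε        = h
⟦⟧-⟶* C h (r ◅ rs) = ⟦⟧-⟶* C (⟦⟧-⟶ C h r) rs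

data Introduction : Term → Set where
  ƛ-intro   : Introduction (ƛ t)
  pair-intro : Introduction ⟨ t , u ⟩
  inl-intro : Introduction (inl t)
  inr-intro : Introduction (inr t)
  ⊕-intro   : Introduction (t ⊕ u)

Neutral : Term → Set
Neutral t = ¬ Introduction t

⟦⟧-introduction-reducts : ∀ C → SN t → (∀ {s} → Introduction s → t ⟶* s → ⟦ C ⟧ s) → ⟦ C ⟧ t
⟦⟧-introduction-reducts ⊤′      sn h = sn
⟦⟧-introduction-reducts ⊥′      sn h = sn
⟦⟧-introduction-reducts (A ⇒ B) sn h = sn , λ rs → proj₂ (h ƛ-intro rs) ε
⟦⟧-introduction-reducts (A ∧ B) sn h = sn , λ rs → proj₂ (h pair-intro rs) ε
⟦⟧-introduction-reducts (A ∨ B) sn h =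
  sn , (λ rs → proj₁ (proj₂ (h inl-intro rs)) ε) , (λ rs → proj₂ (proj₂ (h inr-intro rs)) ε)
⟦⟧-introduction-reducts (A ⊙ B) sn h = sn , λ rs → proj₂ (h ⊕-intro rs) ε

⟦⟧-neutral : ∀ C → Neutral t → (∀ {t′} → t ⟶ t′ → ⟦ C ⟧ t′) → ⟦ C ⟧ t
⟦⟧-neutral C n h = ⟦⟧-introduction-reducts C (acc (⟦⟧-SN C ∘ h)) reduct
  where
  reduct : Introduction s → _ ⟶* s → ⟦ C ⟧ s
  reduct i ε        = ⊥-elim (n i)
  reduct i (r ◅ rs) = ⟦⟧-⟶* C (h r) rs

⟦⟧-var : ∀ C n → ⟦ C ⟧ (var n)
⟦⟧-var C n = ⟦⟧-neutral C (λ ()) (λ ())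

SN-body : ∀ A C → (∀ u → ⟦ A ⟧ u → ⟦ C ⟧ (t [ u ])) → SN t
SN-body A C h = SN-reflect _ subst-⟶ (⟦⟧-SN C (h (var 0) (⟦⟧-var A 0)))

⟦⟧-∥ : ∀ C → ⟦ C ⟧ a → ⟦ C ⟧ b → ⟦ C ⟧ (a ∥ b)
⟦⟧-∥-SN : ∀ C → SN a → SN b → ⟦ C ⟧ a → ⟦ C ⟧ b → ⟦ C ⟧ (a ∥ b)
⟦⟧-∥-reduct : ∀ C → SN a → SN b → ⟦ C ⟧ a → ⟦ C ⟧ b → a ∥ b ⟶ s → ⟦ C ⟧ s
⟦⟧-ƛ-∥ : ∀ C → ⟦ C ⟧ (ƛ t) → ⟦ C ⟧ (ƛ u) → ⟦ C ⟧ (ƛ (t ∥ u))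
⟦⟧-pair-∥ : ∀ C → ⟦ C ⟧ ⟨ t , u ⟩ → ⟦ C ⟧ ⟨ v , w ⟩ → ⟦ C ⟧ ⟨ t ∥ v , u ∥ w ⟩
⟦⟧-⊕-∥ : ∀ C → ⟦ C ⟧ (t ⊕ u) → ⟦ C ⟧ (v ⊕ w) → ⟦ C ⟧ ((t ∥ v) ⊕ (u ∥ w))

⟦⟧-∥ C ha hb = ⟦⟧-∥-SN C (⟦⟧-SN C ha) (⟦⟧-SN C hb) ha hb

⟦⟧-∥-SN C sa sb ha hb = ⟦⟧-neutral C (λ ()) (⟦⟧-∥-reduct C sa sb ha hb)

⟦⟧-∥-reduct C sa       sb       ha hb ∥ƛ      = ⟦⟧-ƛ-∥ C ha hb
⟦⟧-∥-reduct C sa       sb       ha hb ∥pair   = ⟦⟧-pair-∥ C ha hb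
⟦⟧-∥-reduct C sa       sb       ha hb ∥⊕      = ⟦⟧-⊕-∥ C ha hb
⟦⟧-∥-reduct C sa       sb       ha hb ∥idem   = ha
⟦⟧-∥-reduct C sa       sb       ha hb ∥l      = ha
⟦⟧-∥-reduct C sa       sb       ha hb ∥r      = hb
⟦⟧-∥-reduct C (acc ra) sb       ha hb (c∥₁ r) = ⟦⟧-∥-SN C (ra r) sb (⟦⟧-⟶ C ha r) hb
⟦⟧-∥-reduct C sa       (acc rb) ha hb (c∥₂ r) = ⟦⟧-∥-SN C sa (rb r) ha (⟦⟧-⟶ C hb r)

⟦⟧-ƛ-∥ ⊤′      ht hu = SN-ƛ-∥ ht hu
⟦⟧-ƛ-∥ ⊥′      ht hu = SN-ƛ-∥ ht hu
⟦⟧-ƛ-∥ (A ⇒ B) ht hu = SN-ƛ-∥ (proj₁ ht) (proj₁ hu) , λ rs v hv → case ƛ-⟶* rs of λ where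
  (_ , refl , rs′) → ⟦⟧-⟶* B (⟦⟧-∥ B (proj₂ ht ε v hv) (proj₂ hu ε v hv)) (subst-⟶* rs′)
⟦⟧-ƛ-∥ (A ∧ B) ht hu = SN-ƛ-∥ (proj₁ ht) (proj₁ hu) , λ rs → case ƛ-⟶* rs of λ { (_ , () , _) }
⟦⟧-ƛ-∥ (A ∨ B) ht hu =
  SN-ƛ-∥ (proj₁ ht) (proj₁ hu) , (λ rs → case ƛ-⟶* rs of λ { (_ , () , _) })
                               , (λ rs → case ƛ-⟶* rs of λ { (_ , () , _) })
⟦⟧-ƛ-∥ (A ⊙ B) ht hu = SN-ƛ-∥ (proj₁ ht) (proj₁ hu) , λ rs → case ƛ-⟶* rs of λ { (_ , () , _) }

⟦⟧-pair-∥ ⊤′      h₁ h₂ = SN-pair-∥ h₁ h₂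
⟦⟧-pair-∥ ⊥′      h₁ h₂ = SN-pair-∥ h₁ h₂
⟦⟧-pair-∥ (A ⇒ B) h₁ h₂ = SN-pair-∥ (proj₁ h₁) (proj₁ h₂) , λ rs → case pair-⟶* rs of λ { (_ , _ , () , _) }
⟦⟧-pair-∥ (A ∧ B) h₁ h₂ = SN-pair-∥ (proj₁ h₁) (proj₁ h₂) , λ rs → case pair-⟶* rs of λ where
  (_ , _ , refl , rs₁ , rs₂) →
    ⟦⟧-⟶* A (⟦⟧-∥ A (proj₁ (proj₂ h₁ ε)) (proj₁ (proj₂ h₂ ε))) rs₁ ,
    ⟦⟧-⟶* B (⟦⟧-∥ B (proj₂ (proj₂ h₁ ε)) (proj₂ (proj₂ h₂ ε))) rs₂
⟦⟧-pair-∥ (A ∨ B) h₁ h₂ =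
  SN-pair-∥ (proj₁ h₁) (proj₁ h₂) , (λ rs → case pair-⟶* rs of λ { (_ , _ , () , _) })
                                  , (λ rs → case pair-⟶* rs of λ { (_ , _ , () , _) })
⟦⟧-pair-∥ (A ⊙ B) h₁ h₂ = SN-pair-∥ (proj₁ h₁) (proj₁ h₂) , λ rs → case pair-⟶* rs of λ { (_ , _ , () , _) }

⟦⟧-⊕-∥ ⊤′      h₁ h₂ = SN-⊕-∥ h₁ h₂
⟦⟧-⊕-∥ ⊥′      h₁ h₂ = SN-⊕-∥ h₁ h₂
⟦⟧-⊕-∥ (A ⇒ B) h₁ h₂ = SN-⊕-∥ (proj₁ h₁) (proj₁ h₂) , λ rs → case ⊕-⟶* rs of λ { (_ , _ , () , _) }
⟦⟧-⊕-∥ (A ∧ B) h₁ h₂ = SN-⊕-∥ (proj₁ h₁) (proj₁ h₂) , λ rs → case ⊕-⟶* rs of λ { (_ , _ , () , _) }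
⟦⟧-⊕-∥ (A ∨ B) h₁ h₂ =
  SN-⊕-∥ (proj₁ h₁) (proj₁ h₂) , (λ rs → case ⊕-⟶* rs of λ { (_ , _ , () , _) })
                               , (λ rs → case ⊕-⟶* rs of λ { (_ , _ , () , _) })
⟦⟧-⊕-∥ (A ⊙ B) h₁ h₂ = SN-⊕-∥ (proj₁ h₁) (proj₁ h₂) , λ rs → case ⊕-⟶* rs of λ where
  (_ , _ , refl , rs₁ , rs₂) →
    ⟦⟧-⟶* A (⟦⟧-∥ A (proj₁ (proj₂ h₁ ε)) (proj₁ (proj₂ h₂ ε))) rs₁ ,
    ⟦⟧-⟶* B (⟦⟧-∥ B (proj₂ (proj₂ h₁ ε)) (proj₂ (proj₂ h₂ ε))) rs₂

module _ (A B C : Prop) where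

  ⟦⟧-δ∨-SN : SN t → SN u → SN v → ⟦ A ∨ B ⟧ t
           → (∀ a → ⟦ A ⟧ a → ⟦ C ⟧ (u [ a ]))
           → (∀ b → ⟦ B ⟧ b → ⟦ C ⟧ (v [ b ]))
           → ⟦ C ⟧ (δ∨ t u v)
  ⟦⟧-δ∨-reduct : SN t → SN u → SN v → ⟦ A ∨ B ⟧ t
               → (∀ a → ⟦ A ⟧ a → ⟦ C ⟧ (u [ a ]))
               → (∀ b → ⟦ B ⟧ b → ⟦ C ⟧ (v [ b ]))
               → δ∨ t u v ⟶ s → ⟦ C ⟧ s

  ⟦⟧-δ∨-SN st su sv ht hu hv = ⟦⟧-neutral C (λ ()) (⟦⟧-δ∨-reduct st su sv ht hu hv)

  ⟦⟧-δ∨-reduct st su sv ht hu hv β∨l = hu _ (proj₁ (proj₂ ht) ε)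
  ⟦⟧-δ∨-reduct st su sv ht hu hv β∨r = hv _ (proj₂ (proj₂ ht) ε)
  ⟦⟧-δ∨-reduct (acc rt) su sv ht hu hv ∥δ∨ =
    ⟦⟧-∥ C (⟦⟧-δ∨-SN (rt ∥l) su sv (⟦⟧-⟶ (A ∨ B) ht ∥l) hu hv)
           (⟦⟧-δ∨-SN (rt ∥r) su sv (⟦⟧-⟶ (A ∨ B) ht ∥r) hu hv)
  ⟦⟧-δ∨-reduct (acc rt) su sv ht hu hv (cδ∨₁ r) =
    ⟦⟧-δ∨-SN (rt r) su sv (⟦⟧-⟶ (A ∨ B) ht r) hu hv
  ⟦⟧-δ∨-reduct st (acc ru) sv ht hu hv (cδ∨₂ r) =
    ⟦⟧-δ∨-SN st (ru r) sv ht (λ a ha → ⟦⟧-⟶ C (hu a ha) (subst-⟶ r)) hv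
  ⟦⟧-δ∨-reduct st su (acc rv) ht hu hv (cδ∨₃ r) =
    ⟦⟧-δ∨-SN st su (rv r) ht hu (λ b hb → ⟦⟧-⟶ C (hv b hb) (subst-⟶ r))

mainTheorem9 : (A B C : Prop) (t₁ t₂ t₃ : Term)
    → ⟦ A ∨ B ⟧ t₁
    → (∀ u → ⟦ A ⟧ u → ⟦ C ⟧ (t₂ [ u ]))
    → (∀ v → ⟦ B ⟧ v → ⟦ C ⟧ (t₃ [ v ]))
    → ⟦ C ⟧ (δ∨ t₁ t₂ t₃)
mainTheorem9 A B C t₁ t₂ t₃ h₁ h₂ h₃ =
  ⟦⟧-δ∨-SN A B C (⟦⟧-SN (A ∨ B) h₁) (SN-body A C h₂) (SN-body B C h₃) h₁ h₂ h₃
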